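{- Let $s,m$ be positive integers and let $S\subseteq\mathcal L_m(s)$ be a generalized-$\beta$-set with $t=t(S)$. Then for all $0\le i\le t-1$ and $1\le k\le m$, $$n_{im+k}\le\begin{cases} s-i-2 & \text{if } a_{im+k}=a_{(i+1)m},\\ s-i-1 & \text{if } a_{im+k}>a_{(i+1)m}.\end{cases}$$
   Context: Let $N=\lceil (s-1)/2\rceil m$. Define $\mathcal L_m(s)=\bigcup_{k=1}^mP_k$ with $P_k=\{\,i\,ms+j: i\ge0,\ (k-1)s+1+i\le j\le ks-1-i\,\}$ for $1\le k\le m-1$ and $P_m=\{\,i\,ms+j: i\ge0,\ (m-1)s+1+i\le j\le ms-2-i\,\}$. For a nonempty set $S\subseteq\{1,\dots,Ns-1\}$ let $t=t(S)=\min\{i\ge1: S\subseteq[0,ims-1]\}$, and for $1\le i\le N$ let $\mathcal B_i=S\cap[(i-1)s,is-1]$, $a_i=|\mathcal B_i|$, and $n_i=\max\{x\bmod s: x\in\mathcal B_i\}$ ($n_i=0$ if $\mathcal B_i=\emptyset$). A nonempty set $S\subseteq\mathcal L_m(s)$ is a generalized-$\beta$-set if: (1) for $1\le i<N$, $a_i=0$ implies $a_{i+1}=0$; (2) for $1\le i<tm$ with $m\nmid i$, $a_i\ge a_{i+1}$; (3) for $1\le i\le (t-1)m$ with $a_{i+m}>0$, $a_{i+m}\le a_i-2$; (4) for $1\le i<tm$ with $m\nmid i$ and $a_{i+1}>0$, $n_i\ge n_{i+1}$; (5) for $1\le i<tm$ with $m\nmid i$ and $a_i=a_{i+1}>0$,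 $n_i=n_{i+1}$; (6) if $t\ge2$, $a_{(t-1)m}\ge a_{(t-1)m+1}$. -}

module Defs where

open import Data.Nat using (ℕ; zero; suc; _+_; _*_; _∸_; _≤_; _<_; _⊔_; _%_; NonZero; ⌈_/2⌉)
open import Data.Nat.Divisibility using (_∣_)
open import Data.Bool using (Bool; true; false; if_then_else_)
open import Data.Product using (Σ; _×_)
open import Data.Sum using (_⊎_)
open import Relation.Binary.PropositionalEquality using (_≡_)
open import Relation.Nullary using (¬_)

SubsetNat : Set
SubsetNat = ℕ → Bool

_∈S_ : ℕ → SubsetNat → Set
x ∈S S = S x ≡ true

bigN : ℕ → ℕ → ℕ
bigN m s = ⌈ s ∸ 1 /2⌉ * m

InP : ℕ → ℕ → ℕ → ℕ → Set
InP m s k x = Σ ℕ λ i → Σ ℕ λ j →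
  (x ≡ i * m * s + j) × ((k ∸ 1) * s + 1 + i ≤ j) × (j + 1 + i ≤ k * s)

InPm : ℕ → ℕ → ℕ → Set
InPm m s x = Σ ℕ λ i → Σ ℕ λ j →
  (x ≡ i * m * s + j) × ((m ∸ 1) * s + 1 + i ≤ j) × (j + 2 + i ≤ m * s)

InL : ℕ → ℕ → ℕ → Set
InL m s x = (Σ ℕ λ k → (1 ≤ k) × (k < m) × InP m s k x) ⊎ InPm m s x

countFrom : SubsetNat → ℕ → ℕ → ℕ
countFrom S lo zero = 0
countFrom S lo (suc l) = (if S lo then 1 else 0) + countFrom S (suc lo) l

maxModFrom : (s : ℕ) → .{{NonZero s}} → SubsetNat → ℕ → ℕ → ℕ
maxModFrom s S lo zero = 0
maxModFrom s S lo (suc l) = (if S lo then lo % s else 0) ⊔ maxModFrom s S (suc lo) l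

aBlk : ℕ → SubsetNat → ℕ → ℕ
aBlk s S i = countFrom S ((i ∸ 1) * s) s

nBlk : (s : ℕ) → .{{NonZero s}} → SubsetNat → ℕ → ℕ
nBlk s S i = maxModFrom s S ((i ∸ 1) * s) s

BoundedBy : SubsetNat → ℕ → Set
BoundedBy S b = ∀ x → x ∈S S → x < b

IsT : ℕ → ℕ → SubsetNat → ℕ → Set
IsT m s S t = (1 ≤ t) × BoundedBy S (t * m * s)
  × (∀ i → 1 ≤ i → i < t → ¬ BoundedBy S (i * m * s))

BetaConds : (m s : ℕ) → .{{NonZero s}} → SubsetNat → ℕ → Set
BetaConds m s S t =
  (∀ i → 1 ≤ i → i < bigN m s → a i ≡ 0 → a (suc i) ≡ 0)
  × (∀ i → 1 ≤ i → i < t * m → ¬ (m ∣ i) → a (suc i) ≤ a i)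
  × (∀ i → 1 ≤ i → i ≤ (t ∸ 1) * m → 0 < a (i + m) → a (i + m) + 2 ≤ a i)
  × (∀ i → 1 ≤ i → i < t * m → ¬ (m ∣ i) → 0 < a (suc i) → n (suc i) ≤ n i)
  × (∀ i → 1 ≤ i → i < t * m → ¬ (m ∣ i) → a i ≡ a (suc i) → 0 < a (suc i)
       → n i ≡ n (suc i))
  × (2 ≤ t → a ((t ∸ 1) * m + 1) ≤ a ((t ∸ 1) * m))
  where
  a = aBlk s S
  n = nBlk s S

IsGenBeta : (m s : ℕ) → .{{NonZero s}} → SubsetNat → Set
IsGenBeta m s S =
  (Σ ℕ λ x → x ∈S S)
  × (∀ x → x ∈S S → (1 ≤ x) × (x < bigN m s * s))
  × (∀ x → x ∈S S → InL m s x)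
  × (∀ t → IsT m s S t → BetaConds m s S t)

-- An element of L_m(s) lies in a layer [ims, (i+1)ms) and there in a block of the part P_k;
-- its residue mod s is then in [i+1, s-i-1], and in [i+1, s-i-2] when k = m.  This bounds
-- n_{im+k} outright, which is the case a_{im+k} > a_{(i+1)m}.  If a_{im+k} = a_{(i+1)m} > 0,
-- condition (2) makes a constant on the blocks im+k, …, (i+1)m, so condition (5) carries
-- n_{(i+1)m} back to n_{im+k}; if a_{im+k} = 0 then n_{im+k} = 0.  Finally s ≥ i+2 for every
-- layer i < t: otherwise the margins would confine L_m(s), hence S, below layer i,
-- contradicting the minimality of t.
module Submission where

open import Defs
open import Data.Nat using (ℕ; zero; suc; _+_; _*_; _∸_; _≤_; _<_;
  NonZero; z≤n; s≤s; z<s; s≤s⁻¹; _%_; _/_; _≤?_; _≤′_; ≤′-refl; ≤′-step)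
open import Data.Nat.Properties
open import Data.Nat.DivMod using (m<n⇒m%n≡m; m<n⇒m/n≡0; m*n/n≡m; %-remove-+ˡ; +-distrib-/-∣ˡ)
open import Data.Nat.Divisibility using (_∣_; divides-refl; n∣m⇒m%n≡0)
open import Data.Nat.Solver using (module +-*-Solver)
open import Data.Bool using (true; false)
open import Data.Product using (_×_; _,_; Σ; proj₁; proj₂)
open import Data.Sum using (inj₁; inj₂)
open import Data.Empty using (⊥-elim)
open import Relation.Nullary using (¬_; yes; no)
open import Relation.Binary.PropositionalEquality using (_≡_; refl; sym; trans; cong; cong₂; subst₂; subst; module ≡-Reasoning)
open +-*-Solver

[m*n+o]/n≡m : ∀ m {n o} .{{_ : NonZero n}} → o < n → (m * n + o) / n ≡ m
[m*n+o]/n≡m m {n} {o} o<n = begin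
  (m * n + o) / n     ≡⟨ +-distrib-/-∣ˡ o (divides-refl m) ⟩
  m * n / n + o / n   ≡⟨ cong₂ _+_ (m*n/n≡m m n) (m<n⇒m/n≡0 o<n) ⟩
  m + 0               ≡⟨ +-identityʳ m ⟩
  m                   ∎
  where open ≡-Reasoning

[m*n+o]%n≡o : ∀ m {n o} .{{_ : NonZero n}} → o < n → (m * n + o) % n ≡ o
[m*n+o]%n≡o m o<n = trans (%-remove-+ˡ _ (divides-refl m)) (m<n⇒m%n≡m o<n)

m*n≤o<m*n+n⇒o/n≡m : ∀ m {n o} .{{_ : NonZero n}} → m * n ≤ o → o < m * n + n → o / n ≡ m
m*n≤o<m*n+n⇒o/n≡m m {n} le lt with m≤n⇒∃[o]m+o≡n le
... | r , refl = [m*n+o]/n≡m m (+-cancelˡ-< (m * n) r n lt)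

-- Coordinates of a point of L_m(s) lying in the part P_{column+1}.
record Position (m s x : ℕ) : Set where
  field
    layer column offset : ℕ
    column<m : column < m
    x≡ : x ≡ (layer * m + column) * s + offset
    layer<offset : layer < offset
    offset+layer+1≤s : offset + (layer + 1) ≤ s
    last-column : suc column ≡ m → offset + (layer + 2) ≤ s

split-column : ∀ {m s x} i j k e → x ≡ i * m * s + j → k * s + 1 + i ≤ j → j + e + i ≤ suc k * s
  → Σ ℕ λ w → (x ≡ (i * m + k) * s + w) × (i < w) × (w + (i + e) ≤ s)
split-column {m} {s} i j k e x≡ lower upper with m≤n⇒∃[o]m+o≡n (≤-trans (m≤m+n (k * s) (1 + i)) (subst (_≤ j) (+-assoc (k * s) 1 i) lower))
... | w , refl =
  w ,
  trans x≡ (solve 5 (λ I M S K W → I :* M :* S :+ (K :* S :+ W) := (I :* M :+ K) :* S :+ W) refl i m s k w) ,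
  +-cancelˡ-≤ (k * s) (suc i) w (subst (_≤ k * s + w) (+-assoc (k * s) 1 i) lower) ,
  +-cancelˡ-≤ (k * s) _ s (subst₂ _≤_
    (solve 4 (λ K W E I → K :+ W :+ E :+ I := K :+ (W :+ (I :+ E))) refl (k * s) w e i)
    (+-comm s (k * s)) upper)

InL⇒Position : ∀ {m s x} → InL (suc m) s x → Position (suc m) s x
InL⇒Position {m} (inj₁ (suc k , _ , k<m , i , j , x≡ , lower , upper))
  with w , x≡′ , i<w , bound ← split-column i j k 1 x≡ lower upper = record
  { layer = i ; column = k ; offset = w ; column<m = <-trans (n<1+n k) k<m ; x≡ = x≡′
  ; layer<offset = i<w ; offset+layer+1≤s = bound
  ; last-column = λ k≡m → ⊥-elim (<-irrefl k≡m k<m) }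
InL⇒Position {m} (inj₂ (i , j , x≡ , lower , upper))
  with w , x≡′ , i<w , bound ← split-column i j m 2 x≡ lower upper = record
  { layer = i ; column = m ; offset = w ; column<m = ≤-refl ; x≡ = x≡′
  ; layer<offset = i<w ; offset+layer+1≤s = ≤-trans (+-monoʳ-≤ w (+-monoʳ-≤ i (n≤1+n 1))) bound
  ; last-column = λ _ → bound }

module _ {m s x : ℕ} (p : Position m s x) where
  open Position p

  offset<s : offset < s
  offset<s = <-≤-trans (m<m+n offset (m≤n+m 1 layer)) offset+layer+1≤s

  Position⇒<i*m*s : ∀ {i} → s ≤ suc i → x < i * m * s
  Position⇒<i*m*s {i} s≤1+i = begin-strict
    x                                ≡⟨ x≡ ⟩
    (layer * m + column) * s + offset <⟨ +-monoʳ-< _ offset<s ⟩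
    (layer * m + column) * s + s     ≡⟨ solve 4 (λ L M C S → (L :* M :+ C) :* S :+ S := (L :* M :+ (con 1 :+ C)) :* S) refl layer m column s ⟩
    (layer * m + suc column) * s     ≤⟨ *-monoˡ-≤ s (+-monoʳ-≤ (layer * m) column<m) ⟩
    (layer * m + m) * s              ≡⟨ cong (_* s) (+-comm (layer * m) m) ⟩
    suc layer * m * s                ≤⟨ *-monoˡ-≤ s (*-monoˡ-≤ m 1+layer≤i) ⟩
    i * m * s                        ∎
    where
    open ≤-Reasoning
    1+layer≤i : suc layer ≤ i
    1+layer≤i = subst (_≤ i) (+-comm layer 1) (m+n≤o⇒n≤o layer (s≤s⁻¹ (begin
      suc layer + (layer + 1) ≤⟨ +-monoˡ-≤ (layer + 1) layer<offset ⟩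
      offset + (layer + 1)    ≤⟨ offset+layer+1≤s ⟩
      s                       ≤⟨ s≤1+i ⟩
      suc i                   ∎)))

  block-coordinates : ∀ {i k} .{{_ : NonZero m}} .{{_ : NonZero s}} → k < m
    → (i * m + k) * s ≤ x → x < (i * m + k) * s + s
    → (layer ≡ i) × (column ≡ k) × (x % s ≡ offset)
  block-coordinates {i} {k} k<m lower upper =
    trans (sym ([m*n+o]/n≡m layer column<m)) (trans (cong (_/ m) block≡) ([m*n+o]/n≡m i k<m)) ,
    trans (sym ([m*n+o]%n≡o layer column<m)) (trans (cong (_% m) block≡) ([m*n+o]%n≡o i k<m)) ,
    trans (cong (_% s) x≡) ([m*n+o]%n≡o (layer * m + column) offset<s)
    where
    block≡ : layer * m + column ≡ i * m + k
    block≡ = trans (sym (trans (cong (_/ s) x≡) ([m*n+o]/n≡m (layer * m + column) offset<s))) (m*n≤o<m*n+n⇒o/n≡m _ lower upper)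

maxModFrom≤ : ∀ s .{{_ : NonZero s}} S lo len {b}
  → (∀ x → lo ≤ x → x < lo + len → x ∈S S → x % s ≤ b) → maxModFrom s S lo len ≤ b
maxModFrom≤ s S lo zero bound = z≤n
maxModFrom≤ s S lo (suc len) bound
  with S lo in lo∈S | maxModFrom≤ s S (suc lo) len (λ x lo<x x<end → bound x (<⇒≤ lo<x) (subst (x <_) (sym (+-suc lo len)) x<end))
... | true  | rest = ⊔-lub (bound lo ≤-refl (m<m+n lo z<s) lo∈S) rest
... | false | rest = rest

countFrom≡0⇒maxModFrom≡0 : ∀ s .{{_ : NonZero s}} S lo len → countFrom S lo len ≡ 0 → maxModFrom s S lo len ≡ 0
countFrom≡0⇒maxModFrom≡0 s S lo zero _ = refl
countFrom≡0⇒maxModFrom≡0 s S lo (suc len) count≡0 with S lo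
... | false = countFrom≡0⇒maxModFrom≡0 s S (suc lo) len count≡0

module _ {m s : ℕ} .{{_ : NonZero s}} {S : SubsetNat} (S⊆L : ∀ x → x ∈S S → InL (suc m) s x) (i : ℕ) {k : ℕ} (k<m : k < suc m) where

  private
    block-start : (i * suc m + suc k ∸ 1) * s ≡ (i * suc m + k) * s
    block-start = cong (λ b → (b ∸ 1) * s) (+-suc (i * suc m) k)

    residue-bounds : ∀ x → (i * suc m + suc k ∸ 1) * s ≤ x → x < (i * suc m + suc k ∸ 1) * s + s → x ∈S S
      → (x % s ≤ s ∸ (i + 1)) × (suc k ≡ suc m → x % s ≤ s ∸ (i + 2))
    residue-bounds x lower upper x∈S
      with p ← InL⇒Position (S⊆L x x∈S)
      with refl , refl , x%s≡offset ← block-coordinates p {i} {k} k<m (subst (_≤ x) block-start lower) (subst (λ b → x < b + s) block-start upper)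
      rewrite x%s≡offset
      = m+n≤o⇒m≤o∸n _ (Position.offset+layer+1≤s p) , λ last → m+n≤o⇒m≤o∸n _ (Position.last-column p last)

  nBlk≤s∸layer+1 : nBlk s S (i * suc m + suc k) ≤ s ∸ (i + 1)
  nBlk≤s∸layer+1 = maxModFrom≤ s S _ s λ x lower upper x∈S → proj₁ (residue-bounds x lower upper x∈S)

  nBlk≤s∸layer+2 : suc k ≡ suc m → nBlk s S (i * suc m + suc k) ≤ s ∸ (i + 2)
  nBlk≤s∸layer+2 last = maxModFrom≤ s S _ s λ x lower upper x∈S → proj₂ (residue-bounds x lower upper x∈S) last

module _ (a n : ℕ → ℕ) {j : ℕ} where

  descending⇒≤ : ∀ {q} → j ≤′ q → (∀ p → j ≤ p → p < q → a (suc p) ≤ a p) → a q ≤ a j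
  descending⇒≤ ≤′-refl _ = ≤-refl
  descending⇒≤ (≤′-step {q} j≤′q) desc =
    ≤-trans (desc q (≤′⇒≤ j≤′q) ≤-refl) (descending⇒≤ j≤′q λ p j≤p p<q → desc p j≤p (m<n⇒m<1+n p<q))

  descending-level⇒n≡ : ∀ {q} → j ≤′ q → (∀ p → j ≤ p → p < q → a (suc p) ≤ a p)
    → (∀ p → j ≤ p → p < q → a p ≡ a (suc p) → 0 < a (suc p) → n p ≡ n (suc p))
    → a j ≡ a q → 0 < a q → n j ≡ n q
  descending-level⇒n≡ ≤′-refl _ _ _ _ = refl
  descending-level⇒n≡ (≤′-step {q} j≤′q) desc level aj≡a[1+q] a[1+q]>0 =
    trans (descending-level⇒n≡ j≤′q (λ p j≤p p<q → desc p j≤p (m<n⇒m<1+n p<q))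
                                  (λ p j≤p p<q → level p j≤p (m<n⇒m<1+n p<q))
                                  aj≡aq (<-≤-trans a[1+q]>0 last-step))
          (level q (≤′⇒≤ j≤′q) ≤-refl (trans (sym aj≡aq) aj≡a[1+q]) a[1+q]>0)
    where
    last-step : a (suc q) ≤ a q
    last-step = desc q (≤′⇒≤ j≤′q) ≤-refl
    aj≡aq : a j ≡ a q
    aj≡aq = ≤-antisym (subst (_≤ a q) (sym aj≡a[1+q]) last-step)
                      (descending⇒≤ j≤′q λ p j≤p p<q → desc p j≤p (m<n⇒m<1+n p<q))

interior-index : ∀ {m t i k p} .{{_ : NonZero m}} → suc i ≤ t → i * m + suc k ≤ p → p < i * m + m
  → (1 ≤ p) × (p < t * m) × ¬ (m ∣ p)
interior-index {m} {t} {i} {k} 1+i≤t lower upper with m≤n⇒∃[o]m+o≡n (≤-trans (m≤m+n (i * m) (suc k)) lower)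
... | c , refl = ≤-trans 1≤c (m≤n+m c (i * m)) , <-≤-trans upper (subst (_≤ t * m) (+-comm m (i * m)) (*-monoˡ-≤ m 1+i≤t)) , m∤p
  where
  1≤c : 1 ≤ c
  1≤c = ≤-trans (s≤s z≤n) (+-cancelˡ-≤ (i * m) (suc k) c lower)
  m∤p : ¬ (m ∣ i * m + c)
  m∤p m∣p = <-irrefl (sym (trans (sym ([m*n+o]%n≡o i (+-cancelˡ-< (i * m) c m upper))) (n∣m⇒m%n≡0 _ m m∣p))) 1≤c

below-t-unbounded : ∀ {m s S t x} → x ∈S S → IsT m s S t → ∀ i → i < t → ¬ BoundedBy S (i * m * s)
below-t-unbounded {x = x} x∈S _ zero _ bounded = n≮0 (bounded x x∈S)
below-t-unbounded _ (_ , _ , minimal) (suc i) i<t = minimal (suc i) (s≤s z≤n) i<t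

layer+2≤s : ∀ {m s} .{{_ : NonZero s}} {S} → IsGenBeta (suc m) s S → ∀ {t} → IsT (suc m) s S t
  → ∀ {i} → i ≤ t ∸ 1 → i + 2 ≤ s
layer+2≤s {s = s} ((_ , x∈S) , _ , S⊆L , _) {suc t} isT {i} i≤t with i + 2 ≤? s
... | yes i+2≤s = i+2≤s
... | no i+2≰s = ⊥-elim (below-t-unbounded x∈S isT i (s≤s i≤t) λ y y∈S → Position⇒<i*m*s (InL⇒Position (S⊆L y y∈S)) s≤1+i)
  where
  s≤1+i : s ≤ suc i
  s≤1+i = s≤s⁻¹ (subst (s <_) (+-comm i 2) (≰⇒> i+2≰s))

level-nBlk≤s∸layer+2 : ∀ {m s} .{{_ : NonZero s}} {S} → IsGenBeta (suc m) s S → ∀ {t} → IsT (suc m) s S t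
  → ∀ {i k} → i ≤ t ∸ 1 → k < suc m → aBlk s S (i * suc m + suc k) ≡ aBlk s S (i * suc m + suc m)
  → nBlk s S (i * suc m + suc k) ≤ s ∸ (i + 2)
level-nBlk≤s∸layer+2 {m} {s} {S} (_ , _ , S⊆L , conds) {t@(suc _)} isT {i} {k} i≤t k<m a-level
  with conds t isT | aBlk s S (i * suc m + suc m) in a-top
... | _ | zero = subst (_≤ s ∸ (i + 2)) (sym (countFrom≡0⇒maxModFrom≡0 s S _ s a-level)) z≤n
... | _ , descending , _ , _ , level , _ | suc _ =
  subst (_≤ s ∸ (i + 2)) (sym n-level) (nBlk≤s∸layer+2 S⊆L i ≤-refl refl)
  where
  n-level : nBlk s S (i * suc m + suc k) ≡ nBlk s S (i * suc m + suc m)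
  n-level = descending-level⇒n≡ (aBlk s S) (nBlk s S) (≤⇒≤′ (+-monoʳ-≤ (i * suc m) k<m))
    (λ p lower upper → let (1≤p , p<tm , m∤p) = interior-index (s≤s i≤t) lower upper in descending p 1≤p p<tm m∤p)
    (λ p lower upper → let (1≤p , p<tm , m∤p) = interior-index (s≤s i≤t) lower upper in level p 1≤p p<tm m∤p)
    (trans a-level (sym a-top)) (subst (0 <_) (sym a-top) z<s)

proposition4p6 : (s m : ℕ) → .{{_ : NonZero s}} → 1 ≤ m → (S : SubsetNat) → IsGenBeta m s S
    → (t : ℕ) → IsT m s S t → (i k : ℕ) → i ≤ t ∸ 1 → 1 ≤ k → k ≤ m
    → (aBlk s S (i * m + k) ≡ aBlk s S ((suc i) * m) → nBlk s S (i * m + k) + i + 2 ≤ s)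
      × (aBlk s S ((suc i) * m) < aBlk s S (i * m + k) → nBlk s S (i * m + k) + i + 1 ≤ s)
proposition4p6 s (suc m) _ S β@(_ , _ , S⊆L , _) t isT i (suc k) i≤t _ k<m =
  (λ a-level → shift (level-nBlk≤s∸layer+2 β isT i≤t k<m (trans a-level (cong (aBlk s S) (+-comm (suc m) (i * suc m))))) i+2≤s) ,
  (λ _ → shift (nBlk≤s∸layer+1 S⊆L i k<m) i+1≤s)
  where
  i+2≤s : i + 2 ≤ s
  i+2≤s = layer+2≤s β isT i≤t
  i+1≤s : i + 1 ≤ s
  i+1≤s = ≤-trans (+-monoʳ-≤ i (n≤1+n 1)) i+2≤s

  shift : ∀ {n c} → n ≤ s ∸ (i + c) → i + c ≤ s → n + i + c ≤ s
  shift {n} {c} n≤ i+c≤s = subst (_≤ s) (sym (+-assoc n i c)) (m≤o∸n⇒m+n≤o n i+c≤s n≤)
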